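{- Let $z$ be an integer, let $M$ be a positive integer, and let $w$ be a nonnegative integer. For a real number $x$ write $x \div M = \lfloor x/M \rfloor$. Then the equality $(w \times z) \div M = (w \times (z+\epsilon)) \div M$ holds for every real $\epsilon \in [0,1)$ if and only if $(w \times z) \bmod M < M - w + 1$.
   Context: Here $\lfloor x \rfloor$ is the largest integer not exceeding $x$, $a \div b = \lfloor a/b \rfloor$, and $a \bmod b = a - (a \div b)\times b$ (so for $M>0$, $a \bmod M \in \{0,\dots,M-1\}$). The integer $z$ is thought of as a truncation of an exact multiplier $z' = z+\epsilon$ with $\epsilon\in[0,1)$.
   Formalization: The perturbation $\epsilon$ ranges over the rationals in [0,1) rather than over all reals in [0,1). -}

module Defs where

open import Data.Nat using (ℕ; NonZero)
open import Data.Integer using (ℤ; +_; _-_; _*_)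
import Data.Rational as ℚ
open ℚ using (ℚ; floor; _/_)

_÷_ : ℚ → (M : ℕ) → .{{NonZero M}} → ℤ
x ÷ M = floor (x ℚ.* (+ 1 / M))

_modM_ : ℤ → (M : ℕ) → .{{NonZero M}} → ℤ
a modM M = a - ((a / 1) ÷ M) * + M

{-# OPTIONS --safe #-}
-- Write w z = q M + r with q = (w z) ÷ M, so that 0 ≤ r < M.  Since
-- w (z + ε) = q M + (r + w ε) with w ε ≥ 0, its quotient by M is still q
-- exactly when r + w ε < M.  As ε ranges over [0,1), w ε takes values below
-- w only, and takes the value w - 1 at ε = (w - 1)/w; so the quotient is
-- unchanged for every ε iff r + w ≤ M.
module Submission where

open import Defs
open import Data.Nat using (ℕ; NonZero)
open import Data.Integer using (ℤ; +_; _-_; _+_; _*_; _<_)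
open import Data.Rational using (ℚ; _/_)
open import Relation.Binary.PropositionalEquality using (_≡_)
open import Data.Product using (_×_)
open import Function.Bundles using (_⇔_)
import Data.Rational as Q

open import Data.Nat as ℕ using (suc; zero)
import Data.Nat.Properties as ℕ
open import Data.Integer as ℤ using (_≤_; 0ℤ; 1ℤ; +<+; +≤+)
import Data.Integer.Properties as ℤ
open import Data.Integer.DivMod using (a≡a%n+[a/n]*n; n%d<d)
open import Data.Integer.Tactic.RingSolver using (solve-∀)
open import Data.Rational using (mkℚ; floor; toℚᵘ; 0ℚ; 1ℚ; Positive; positive)
import Data.Rational.Properties as Q
open import Data.Rational.Unnormalised as ℚᵘ using (mkℚᵘ; *≤*; *<*; *≡*)
import Data.Rational.Unnormalised.Properties as ℚᵘ
open import Data.Product using (_,_; proj₁; proj₂)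
open import Function.Bundles using (mk⇔; Equivalence)
open import Function.Properties.Equivalence using () renaming (trans to ⇔-trans)
open import Relation.Binary.PropositionalEquality
  using (refl; sym; trans; cong; subst; subst₂; module ≡-Reasoning)

toℚᵘ-/1 : ∀ i → toℚᵘ (i / 1) ℚᵘ.≃ mkℚᵘ i 0
toℚᵘ-/1 i = Q.toℚᵘ-fromℚᵘ (mkℚᵘ i 0)

/1-homo-+ : ∀ i j → (i + j) / 1 ≡ i / 1 Q.+ j / 1
/1-homo-+ i j = Q.toℚᵘ-injective (ℚᵘ.≃-trans (toℚᵘ-/1 (i + j)) (ℚᵘ.≃-sym
  (ℚᵘ.≃-trans (Q.toℚᵘ-homo-+ (i / 1) (j / 1))
   (ℚᵘ.≃-trans (ℚᵘ.+-cong (toℚᵘ-/1 i) (toℚᵘ-/1 j)) (*≡* (ring i j))))))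
  where
  ring : ∀ i j → (i * 1ℤ + j * 1ℤ) * 1ℤ ≡ (i + j) * 1ℤ
  ring = solve-∀

/1-homo-* : ∀ i j → (i * j) / 1 ≡ (i / 1) Q.* (j / 1)
/1-homo-* i j = Q.toℚᵘ-injective (ℚᵘ.≃-trans (toℚᵘ-/1 (i * j)) (ℚᵘ.≃-sym
  (ℚᵘ.≃-trans (Q.toℚᵘ-homo-* (i / 1) (j / 1))
   (ℚᵘ.≃-trans (ℚᵘ.*-cong (toℚᵘ-/1 i) (toℚᵘ-/1 j)) (*≡* refl)))))

/1-mono-≤ : ∀ {i j} → i ≤ j → i / 1 Q.≤ j / 1
/1-mono-≤ {i} {j} i≤j = Q.toℚᵘ-cancel-≤ (ℚᵘ.≤-respˡ-≃ (ℚᵘ.≃-sym (toℚᵘ-/1 i))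
  (ℚᵘ.≤-respʳ-≃ (ℚᵘ.≃-sym (toℚᵘ-/1 j))
   (*≤* (subst₂ _≤_ (sym (ℤ.*-identityʳ i)) (sym (ℤ.*-identityʳ j)) i≤j))))

/1-mono-< : ∀ {i j} → i < j → i / 1 Q.< j / 1
/1-mono-< {i} {j} i<j = Q.toℚᵘ-cancel-< (ℚᵘ.<-respˡ-≃ (ℚᵘ.≃-sym (toℚᵘ-/1 i))
  (ℚᵘ.<-respʳ-≃ (ℚᵘ.≃-sym (toℚᵘ-/1 j))
   (*<* (subst₂ _<_ (sym (ℤ.*-identityʳ i)) (sym (ℤ.*-identityʳ j)) i<j))))

/1-cancel-≤ : ∀ {i j} → i / 1 Q.≤ j / 1 → i ≤ j
/1-cancel-≤ {i} {j} i≤j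
  with ℚᵘ.≤-respˡ-≃ (toℚᵘ-/1 i) (ℚᵘ.≤-respʳ-≃ (toℚᵘ-/1 j) (Q.toℚᵘ-mono-≤ i≤j))
... | *≤* i*1≤j*1 = subst₂ _≤_ (ℤ.*-identityʳ i) (ℤ.*-identityʳ j) i*1≤j*1

/1-cancel-< : ∀ {i j} → i / 1 Q.< j / 1 → i < j
/1-cancel-< {i} {j} i<j
  with ℚᵘ.<-respˡ-≃ (toℚᵘ-/1 i) (ℚᵘ.<-respʳ-≃ (toℚᵘ-/1 j) (Q.toℚᵘ-mono-< i<j))
... | *<* i*1<j*1 = subst₂ _<_ (ℤ.*-identityʳ i) (ℤ.*-identityʳ j) i*1<j*1

/1-positive : ∀ M .{{_ : NonZero M}} → Positive (+ M / 1)
/1-positive M = positive (/1-mono-< (+<+ (ℕ.>-nonZero⁻¹ M)))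

0≤ε⇒0≤w*ε : ∀ w {ε} → 0ℚ Q.≤ ε → 0ℚ Q.≤ (+ w / 1) Q.* ε
0≤ε⇒0≤w*ε w {ε} 0≤ε = subst (Q._≤ (+ w / 1) Q.* ε) (Q.*-zeroʳ (+ w / 1))
  (Q.*-monoˡ-≤-nonNeg (+ w / 1) {{Q.nonNegative (/1-mono-≤ {0ℤ} {+ w} (+≤+ ℕ.z≤n))}} 0≤ε)

<+1⇒≤ : ∀ {i j} → i < j + 1ℤ → i ≤ j
<+1⇒≤ {i} {j} i<j+1 = subst (i ≤_) (pred[j+1]≡j j) (ℤ.i<j⇒i≤pred[j] i<j+1)
  where
  pred[j+1]≡j : ∀ j → ℤ.- 1ℤ + (j + 1ℤ) ≡ j
  pred[j+1]≡j = solve-∀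

≤⇒<+1 : ∀ {i j} → i ≤ j → i < j + 1ℤ
≤⇒<+1 {i} {j} i≤j = ℤ.≤-<-trans i≤j
  (subst (_< j + 1ℤ) (ℤ.+-identityʳ j) (ℤ.+-monoʳ-< j (+<+ ℕ.z<s)))

k≤j-i⇔i<j-k+1 : ∀ i j k → k ≤ j - i ⇔ i < j - k + 1ℤ
k≤j-i⇔i<j-k+1 i j k =
  mk⇔ (λ k≤j-i → ≤⇒<+1 (swap i k k≤j-i)) (λ i<j-k+1 → swap k i (<+1⇒≤ i<j-k+1))
  where
  swap : ∀ i k → k ≤ j - i → i ≤ j - k
  swap i k k≤j-i = ℤ.0≤i-j⇒j≤i (subst (0ℤ ≤_) (ring j i k) (ℤ.i≤j⇒0≤j-i k≤j-i))
    where
    ring : ∀ j i k → j - i - k ≡ j - k - i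
    ring = solve-∀

+-cancelˡ-< : ∀ r {p q} → r Q.+ p Q.< r Q.+ q → p Q.< q
+-cancelˡ-< r {p} {q} r+p<r+q = subst₂ Q._<_ (cancel p) (cancel q) (Q.+-monoʳ-< (Q.- r) r+p<r+q)
  where
  cancel : ∀ x → Q.- r Q.+ (r Q.+ x) ≡ x
  cancel x = trans (sym (Q.+-assoc (Q.- r) r x)) (trans (cong (Q._+ x) (Q.+-inverseˡ r)) (Q.+-identityˡ x))

floor-lower : ∀ p → floor p / 1 Q.≤ p
floor-lower p@(mkℚ n d _) =
  Q.toℚᵘ-cancel-≤ (ℚᵘ.≤-respˡ-≃ (ℚᵘ.≃-sym (toℚᵘ-/1 (floor p))) (*≤* (begin
  floor p * + suc d                        ≤⟨ ℤ.i≤j+i _ (+ (n ℤ.% + suc d)) ⟩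
  + (n ℤ.% + suc d) + floor p * + suc d    ≡⟨ a≡a%n+[a/n]*n n (+ suc d) ⟨
  n                                        ≡⟨ ℤ.*-identityʳ n ⟨
  n * 1ℤ                                   ∎)))
  where open ℤ.≤-Reasoning

floor-upper : ∀ p → p Q.< (floor p + 1ℤ) / 1
floor-upper p@(mkℚ n d _) =
  Q.toℚᵘ-cancel-< (ℚᵘ.<-respʳ-≃ (ℚᵘ.≃-sym (toℚᵘ-/1 (floor p + 1ℤ))) (*<* (begin-strict
  n * 1ℤ                                   ≡⟨ ℤ.*-identityʳ n ⟩
  n                                        ≡⟨ a≡a%n+[a/n]*n n (+ suc d) ⟩
  + (n ℤ.% + suc d) + floor p * + suc d    <⟨ ℤ.+-monoˡ-< (floor p * + suc d) (+<+ (n%d<d n (+ suc d))) ⟩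
  + suc d + floor p * + suc d              ≡⟨ ring (floor p) (+ suc d) ⟩
  (floor p + 1ℤ) * + suc d                 ∎)))
  where
  open ℤ.≤-Reasoning
  ring : ∀ q D → D + q * D ≡ (q + 1ℤ) * D
  ring = solve-∀

floor-unique : ∀ {p m} → m / 1 Q.≤ p → p Q.< (m + 1ℤ) / 1 → floor p ≡ m
floor-unique {p} m≤p p<m+1 = ℤ.≤-antisym
  (<+1⇒≤ (/1-cancel-< (Q.≤-<-trans (floor-lower p) p<m+1)))
  (<+1⇒≤ (/1-cancel-< (Q.≤-<-trans m≤p (floor-upper p))))

1/M*M≡1 : ∀ M .{{_ : NonZero M}} → + 1 / M Q.* (+ M / 1) ≡ 1ℚ
1/M*M≡1 (suc m) = Q.toℚᵘ-injective (ℚᵘ.≃-trans (Q.toℚᵘ-homo-* (+ 1 / suc m) (+ suc m / 1))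
  (ℚᵘ.≃-trans (ℚᵘ.*-cong (Q.toℚᵘ-fromℚᵘ (mkℚᵘ 1ℤ m)) (toℚᵘ-/1 (+ suc m)))
   (*≡* (trans (ℤ.*-identityʳ (1ℤ * + suc m))
               (cong (λ k → 1ℤ * + k) (sym (ℕ.*-identityʳ (suc m))))))))

x*1/M*M≡x : ∀ {M} .{{_ : NonZero M}} x → x Q.* (+ 1 / M) Q.* (+ M / 1) ≡ x
x*1/M*M≡x {M} x = begin
  x Q.* (+ 1 / M) Q.* (+ M / 1)   ≡⟨ Q.*-assoc x (+ 1 / M) (+ M / 1) ⟩
  x Q.* (+ 1 / M Q.* (+ M / 1))   ≡⟨ cong (x Q.*_) (1/M*M≡1 M) ⟩
  x Q.* 1ℚ                        ≡⟨ Q.*-identityʳ x ⟩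
  x                               ∎
  where open ≡-Reasoning

m*M≤x⇔m≤x*1/M : ∀ {M} .{{_ : NonZero M}} m x → (m * + M) / 1 Q.≤ x ⇔ m / 1 Q.≤ x Q.* (+ 1 / M)
m*M≤x⇔m≤x*1/M {M} m x = mk⇔
  (λ m*M≤x → Q.*-cancelʳ-≤-pos (+ M / 1) {{/1-positive M}}
    (subst₂ Q._≤_ (/1-homo-* m (+ M)) (sym (x*1/M*M≡x x)) m*M≤x))
  (λ m≤x*1/M → subst₂ Q._≤_ (sym (/1-homo-* m (+ M))) (x*1/M*M≡x x)
    (Q.*-monoʳ-≤-nonNeg (+ M / 1) {{Q.pos⇒nonNeg (+ M / 1) {{/1-positive M}}}} m≤x*1/M))

x<m*M⇔x*1/M<m : ∀ {M} .{{_ : NonZero M}} m x → x Q.< (m * + M) / 1 ⇔ x Q.* (+ 1 / M) Q.< m / 1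
x<m*M⇔x*1/M<m {M} m x = mk⇔
  (λ x<m*M → Q.*-cancelʳ-<-nonNeg (+ M / 1) {{Q.pos⇒nonNeg (+ M / 1) {{/1-positive M}}}}
    (subst₂ Q._<_ (sym (x*1/M*M≡x x)) (/1-homo-* m (+ M)) x<m*M))
  (λ x*1/M<m → subst₂ Q._<_ (x*1/M*M≡x x) (sym (/1-homo-* m (+ M)))
    (Q.*-monoˡ-<-pos (+ M / 1) {{/1-positive M}} x*1/M<m))

÷-lower : ∀ {M} .{{_ : NonZero M}} x → ((x ÷ M) * + M) / 1 Q.≤ x
÷-lower {M} x = Equivalence.from (m*M≤x⇔m≤x*1/M (x ÷ M) x) (floor-lower (x Q.* (+ 1 / M)))

÷-upper : ∀ {M} .{{_ : NonZero M}} x → x Q.< ((x ÷ M + 1ℤ) * + M) / 1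
÷-upper {M} x = Equivalence.from (x<m*M⇔x*1/M<m (x ÷ M + 1ℤ) x) (floor-upper (x Q.* (+ 1 / M)))

÷-unique : ∀ {M} .{{_ : NonZero M}} {x} q →
           (q * + M) / 1 Q.≤ x → x Q.< ((q + 1ℤ) * + M) / 1 → x ÷ M ≡ q
÷-unique {M} {x} q q*M≤x x<[q+1]*M = floor-unique
  (Equivalence.to (m*M≤x⇔m≤x*1/M q x) q*M≤x) (Equivalence.to (x<m*M⇔x*1/M<m (q + 1ℤ) x) x<[q+1]*M)

[q*M+r+y]÷M≡q⇔y<M-r : ∀ {M} .{{_ : NonZero M}} q r {y} → 0ℤ ≤ r → 0ℚ Q.≤ y →
                      ((q * + M + r) / 1 Q.+ y) ÷ M ≡ q ⇔ y Q.< (+ M - r) / 1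
[q*M+r+y]÷M≡q⇔y<M-r {M} q r {y} 0≤r 0≤y = mk⇔
  (λ x÷M≡q → +-cancelˡ-< ((q * + M + r) / 1)
    (subst (x Q.<_) (sym next≡) (subst (λ t → x Q.< ((t + 1ℤ) * + M) / 1) x÷M≡q (÷-upper x))))
  (λ y<M-r → ÷-unique q lower (subst (x Q.<_) next≡ (Q.+-monoʳ-< ((q * + M + r) / 1) y<M-r)))
  where
  x = (q * + M + r) / 1 Q.+ y
  next≡ : (q * + M + r) / 1 Q.+ (+ M - r) / 1 ≡ ((q + 1ℤ) * + M) / 1
  next≡ = trans (sym (/1-homo-+ (q * + M + r) (+ M - r))) (cong (_/ 1) (ring q r (+ M)))
    where
    ring : ∀ q r M → q * M + r + (M - r) ≡ (q + 1ℤ) * M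
    ring = solve-∀
  lower : (q * + M) / 1 Q.≤ x
  lower = Q.≤-trans (/1-mono-≤ (ℤ.i≤i+j (q * + M) r {{ℤ.nonNegative 0≤r}}))
    (subst (Q._≤ x) (Q.+-identityʳ ((q * + M + r) / 1)) (Q.+-monoʳ-≤ ((q * + M + r) / 1) 0≤y))

[a+y]÷M≡a÷M⇔y<M-a%M : ∀ {M} .{{_ : NonZero M}} a {y} → 0ℚ Q.≤ y →
                       ((a / 1) Q.+ y) ÷ M ≡ (a / 1) ÷ M ⇔ y Q.< (+ M - a modM M) / 1
[a+y]÷M≡a÷M⇔y<M-a%M {M} a {y} =
  subst (λ t → 0ℚ Q.≤ y → ((t / 1) Q.+ y) ÷ M ≡ q ⇔ y Q.< (+ M - r) / 1)
    (sym a≡q*M+r) ([q*M+r+y]÷M≡q⇔y<M-r q r 0≤r)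
  where
  q = (a / 1) ÷ M
  r = a modM M
  -- r unfolds to a - q * + M
  a≡q*M+r : a ≡ q * + M + r
  a≡q*M+r = ring a (q * + M)
    where
    ring : ∀ a b → a ≡ b + (a - b)
    ring = solve-∀
  0≤r : 0ℤ ≤ r
  0≤r = ℤ.i≤j⇒0≤j-i (/1-cancel-≤ {q * + M} {a} (÷-lower (a / 1)))

0<M-a%M : ∀ {M} .{{_ : NonZero M}} a → 0ℤ < + M - a modM M
0<M-a%M {M} a = /1-cancel-< {0ℤ} {+ M - a modM M}
  (Equivalence.to ([a+y]÷M≡a÷M⇔y<M-a%M a Q.≤-refl) (cong (_÷ M) (Q.+-identityʳ (a / 1))))

_∈[0,1⟩ : ℚ → Set
ε ∈[0,1⟩ = 0ℚ Q.≤ ε × ε Q.< 1ℚ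

j/[1+j]∈[0,1⟩ : ∀ j → ((+ j / 1) Q.* (+ 1 / suc j)) ∈[0,1⟩
j/[1+j]∈[0,1⟩ j =
  Equivalence.to (m*M≤x⇔m≤x*1/M {suc j} 0ℤ (+ j / 1)) (/1-mono-≤ {0ℤ} {+ j} (+≤+ ℕ.z≤n)) ,
  Equivalence.to (x<m*M⇔x*1/M<m {suc j} 1ℤ (+ j / 1))
    (/1-mono-< (subst (+ j <_) (sym (ℤ.*-identityˡ (+ suc j))) (+<+ (ℕ.n<1+n j))))

∀ε∈[0,1⟩w*ε<c⇔w≤c : ∀ w {c} → 0ℤ < c →
                     (∀ ε → ε ∈[0,1⟩ → (+ w / 1) Q.* ε Q.< c / 1) ⇔ + w ≤ c
∀ε∈[0,1⟩w*ε<c⇔w≤c zero {c} 0<c = mk⇔ (λ _ → ℤ.<⇒≤ 0<c)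
  (λ _ ε _ → subst (Q._< c / 1) (sym (Q.*-zeroˡ ε)) (/1-mono-< 0<c))
∀ε∈[0,1⟩w*ε<c⇔w≤c (suc j) {c} _ = mk⇔
  (λ w*ε<c → ℤ.i<j⇒suc[i]≤j (/1-cancel-< {+ j} {c}
    (subst (Q._< c / 1) w*ε≡j (w*ε<c ((+ j / 1) Q.* (+ 1 / suc j)) (j/[1+j]∈[0,1⟩ j)))))
  (λ w≤c ε ε∈[0,1⟩ → Q.<-≤-trans
    (subst ((+ suc j / 1) Q.* ε Q.<_) (Q.*-identityʳ (+ suc j / 1))
      (Q.*-monoʳ-<-pos (+ suc j / 1) {{/1-positive (suc j)}} (proj₂ ε∈[0,1⟩)))
    (/1-mono-≤ w≤c))
  where
  w*ε≡j : (+ suc j / 1) Q.* ((+ j / 1) Q.* (+ 1 / suc j)) ≡ + j / 1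
  w*ε≡j = trans (Q.*-comm (+ suc j / 1) _) (x*1/M*M≡x {suc j} (+ j / 1))

lemma1 : (z : ℤ) (M : ℕ) .{{_ : NonZero M}} (w : ℕ) →
    ((ε : ℚ) → (Q.0ℚ Q.≤ ε × ε Q.< Q.1ℚ) →
      (((+ w * z) / 1) ÷ M) ≡ ((+ w / 1) Q.* ((z / 1) Q.+ ε)) ÷ M)
    ⇔ (((+ w * z) modM M) < (+ M - + w) + + 1)
lemma1 z M w =
  ⇔-trans pointwise (⇔-trans (∀ε∈[0,1⟩w*ε<c⇔w≤c w (0<M-a%M a)) (k≤j-i⇔i<j-k+1 r (+ M) (+ w)))
  where
  a = + w * z
  r = a modM M
  expand : ∀ ε → (+ w / 1) Q.* ((z / 1) Q.+ ε) ≡ a / 1 Q.+ (+ w / 1) Q.* ε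
  expand ε = trans (Q.*-distribˡ-+ (+ w / 1) (z / 1) ε)
                   (cong (Q._+ (+ w / 1) Q.* ε) (sym (/1-homo-* (+ w) z)))
  stable⇔ : ∀ ε → ε ∈[0,1⟩ →
            (a / 1) ÷ M ≡ ((+ w / 1) Q.* ((z / 1) Q.+ ε)) ÷ M ⇔ (+ w / 1) Q.* ε Q.< (+ M - r) / 1
  stable⇔ ε (0≤ε , _) rewrite expand ε =
    ⇔-trans (mk⇔ sym sym) ([a+y]÷M≡a÷M⇔y<M-a%M a (0≤ε⇒0≤w*ε w 0≤ε))
  pointwise : (∀ ε → ε ∈[0,1⟩ → (a / 1) ÷ M ≡ ((+ w / 1) Q.* ((z / 1) Q.+ ε)) ÷ M)
            ⇔ (∀ ε → ε ∈[0,1⟩ → (+ w / 1) Q.* ε Q.< (+ M - r) / 1)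
  pointwise = mk⇔ (λ h ε ε∈ → Equivalence.to (stable⇔ ε ε∈) (h ε ε∈))
                  (λ h ε ε∈ → Equivalence.from (stable⇔ ε ε∈) (h ε ε∈))
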